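{- Let $F,G:2^V\to\mathbb{R}$ be submodular functions on the same ground set $V$ with $F(\emptyset)=G(\emptyset)=0$ and $F(V)=G(V)=0$, and suppose that for some $\alpha\ge 1$, $\frac1\alpha G(A)\le F(A)\le G(A)$ for all $A\subseteq V$. Then $\frac1\alpha B(G)\subseteq B(F)\subseteq B(G)$.
   Context: For a submodular $H$ with $H(\emptyset)=0$, $B(H)=\{w\in\mathbb{R}^V:w(A)\le H(A)\ \forall A\subseteq V,\ w(V)=H(V)\}$, where $w(A)=\sum_{i\in A}w_i$. -}

module Defs where

open import Level using (0ℓ)
open import Data.Nat using (ℕ; zero; suc)
open import Data.Fin using (Fin; zero; suc)
open import Data.Bool using (Bool; true; false; if_then_else_)
open import Data.Vec using (Vec; []; _∷_)
open import Data.Fin.Subset using (Subset; _∪_; _∩_; ⊥; ⊤)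
open import Data.Product using (_×_)
open import Function using (_∘_)
open import Relation.Binary.Core using (Rel)
open import Relation.Binary.Structures using (IsTotalOrder)
open import Relation.Binary.PropositionalEquality using (_≡_; _≢_)
open import Algebra.Structures using (IsCommutativeRing)

-- An ordered field (ℝ is an instance).  Equality is propositional.
-- The inverse is total (with an arbitrary value at 0); the inverse law
-- is only required for nonzero elements.
record OrderedField : Set₁ where
  infixl 6 _+_
  infixl 7 _*_
  infix 4 _≤_
  field
    Carrier  : Set
    _+_ _*_  : Carrier → Carrier → Carrier
    -_       : Carrier → Carrier
    0# 1#    : Carrier
    _⁻¹      : Carrier → Carrier
    _≤_      : Rel Carrier 0ℓ
    isCommutativeRing : IsCommutativeRing _≡_ _+_ _*_ -_ 0# 1#
    isTotalOrder      : IsTotalOrder _≡_ _≤_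
    0≢1      : 0# ≢ 1#
    ⁻¹-inverse : ∀ x → x ≢ 0# → x * (x ⁻¹) ≡ 1#
    +-monoˡ-≤ : ∀ x y z → x ≤ y → x + z ≤ y + z
    *-nonneg  : ∀ x y → 0# ≤ x → 0# ≤ y → 0# ≤ x * y

module _ (K : OrderedField) where
  open OrderedField K

  setSum : ∀ {n} → Subset n → (Fin n → Carrier) → Carrier
  setSum []      w = 0#
  setSum (b ∷ A) w = (if b then w zero else 0#) + setSum A (w ∘ suc)

  Submodular : ∀ {n} → (Subset n → Carrier) → Set
  Submodular H = ∀ A B → H (A ∪ B) + H (A ∩ B) ≤ H A + H B

  InBase : ∀ {n} → (Subset n → Carrier) → (Fin n → Carrier) → Set
  InBase {n} H w = (∀ A → setSum A w ≤ H A) × (setSum ⊤ w ≡ H ⊤)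

{-# OPTIONS --safe #-}
-- Since F ≤ G and F(V) = G(V), every defining constraint of B(F) implies the
-- corresponding one of B(G), so B(F) ⊆ B(G).  Scaling by α⁻¹ ≥ 0 maps B(G)
-- into B(α⁻¹G), and α⁻¹G ≤ F with α⁻¹G(V) = 0 = F(V), so the same argument
-- gives α⁻¹B(G) ⊆ B(F).  Submodularity and the values at ∅ are not needed.
module Submission where

open import Defs
open import Data.Nat using (ℕ)
open import Data.Fin using (Fin; zero; suc)
open import Data.Fin.Subset using (Subset; ⊥; ⊤)
open import Data.Product using (_×_; _,_)
open import Data.Sum using (inj₁; inj₂)
open import Data.Vec using ([]; _∷_)
open import Data.Bool using (true; false)
open import Function using (_∘_)
open import Relation.Nullary using (¬_; contradiction)
open import Relation.Binary.PropositionalEquality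
open import Relation.Binary.Structures using (IsTotalOrder)
open import Algebra.Structures using (IsCommutativeRing)
open import Algebra.Bundles using (CommutativeRing)
import Algebra.Properties.Ring as RingProperties

module OrderedFieldProperties (K : OrderedField) where
  open OrderedField K
  open IsCommutativeRing isCommutativeRing public
    using (_-_; +-identityˡ; +-identityʳ; +-assoc; -‿inverseˡ; -‿inverseʳ; distribˡ; zeroʳ)
  open IsTotalOrder isTotalOrder using (antisym; total) renaming (trans to ≤-trans)

  ring : CommutativeRing _ _
  ring = record { isCommutativeRing = isCommutativeRing }

  open RingProperties (CommutativeRing.ring ring) using (-‿distribʳ-*; -1*x≈-x; -‿involutive; x[y-z]≈xy-xz)

  x≤y⇒0≤y-x : ∀ {x y} → x ≤ y → 0# ≤ y - x
  x≤y⇒0≤y-x {x} {y} x≤y = subst (_≤ y - x) (-‿inverseʳ x) (+-monoˡ-≤ x y (- x) x≤y)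

  0≤y-x⇒x≤y : ∀ {x y} → 0# ≤ y - x → x ≤ y
  0≤y-x⇒x≤y {x} {y} 0≤y-x = subst₂ _≤_ (+-identityˡ x) y-x+x≡y (+-monoˡ-≤ 0# (y - x) x 0≤y-x)
    where
    open ≡-Reasoning
    y-x+x≡y : y - x + x ≡ y
    y-x+x≡y = begin
      y - x + x     ≡⟨ +-assoc y (- x) x ⟩
      y + (- x + x) ≡⟨ cong (y +_) (-‿inverseˡ x) ⟩
      y + 0#        ≡⟨ +-identityʳ y ⟩
      y             ∎

  x≤0⇒0≤-x : ∀ {x} → x ≤ 0# → 0# ≤ - x
  x≤0⇒0≤-x {x} x≤0 = subst (0# ≤_) (+-identityˡ (- x)) (x≤y⇒0≤y-x x≤0)

  *-monoʳ-≤-nonneg : ∀ {c x y} → 0# ≤ c → x ≤ y → c * x ≤ c * y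
  *-monoʳ-≤-nonneg {c} {x} {y} 0≤c x≤y =
    0≤y-x⇒x≤y (subst (0# ≤_) (x[y-z]≈xy-xz c y x) (*-nonneg c (y - x) 0≤c (x≤y⇒0≤y-x x≤y)))

  -- If 1 ≤ 0, the square of the nonnegative element -1 would be 1 ≥ 0 anyway.
  0≤1 : 0# ≤ 1#
  0≤1 with total 0# 1#
  ... | inj₁ 0≤1 = 0≤1
  ... | inj₂ 1≤0 = subst (0# ≤_) -1*-1≡1 (*-nonneg (- 1#) (- 1#) 0≤-1 0≤-1)
    where
    0≤-1 = x≤0⇒0≤-x 1≤0
    -1*-1≡1 : - 1# * - 1# ≡ 1#
    -1*-1≡1 = trans (-1*x≈-x (- 1#)) (-‿involutive 1#)

  1≰0 : ¬ (1# ≤ 0#)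
  1≰0 1≤0 = 0≢1 (antisym 0≤1 1≤0)

  1≤x⇒0≤x⁻¹ : ∀ {x} → 1# ≤ x → 0# ≤ x ⁻¹
  1≤x⇒0≤x⁻¹ {x} 1≤x with total 0# (x ⁻¹)
  ... | inj₁ 0≤x⁻¹ = 0≤x⁻¹
  ... | inj₂ x⁻¹≤0 = contradiction (0≤y-x⇒x≤y (subst (0# ≤_) (sym (+-identityˡ (- 1#))) 0≤-1)) 1≰0
    where
    x≢0 : x ≢ 0#
    x≢0 x≡0 = 1≰0 (subst (1# ≤_) x≡0 1≤x)
    0≤-1 : 0# ≤ - 1#
    0≤-1 = subst (0# ≤_) (trans (sym (-‿distribʳ-* x (x ⁻¹))) (cong -_ (⁻¹-inverse x x≢0)))
             (*-nonneg x (- (x ⁻¹)) (≤-trans 0≤1 1≤x) (x≤0⇒0≤-x x⁻¹≤0))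

module BasePolytope (K : OrderedField) where
  open OrderedField K
  open OrderedFieldProperties K
  open IsTotalOrder isTotalOrder using () renaming (trans to ≤-trans)

  setSum-*ˡ : ∀ {n} c (A : Subset n) (w : Fin n → Carrier) →
              setSum K A (λ i → c * w i) ≡ c * setSum K A w
  setSum-*ˡ c []          w = sym (zeroʳ c)
  setSum-*ˡ c (true ∷ A)  w = trans (cong (c * w zero +_) (setSum-*ˡ c A (λ i → w (suc i))))
                                    (sym (distribˡ c (w zero) (setSum K A (λ i → w (suc i)))))
  setSum-*ˡ c (false ∷ A) w = trans (cong (0# +_) (setSum-*ˡ c A (λ i → w (suc i))))
                                    (trans (+-identityˡ _) (cong (c *_) (sym (+-identityˡ _))))

  InBase-mono : ∀ {n} {F G : Subset n → Carrier} {w : Fin n → Carrier} →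
                (∀ A → F A ≤ G A) → F ⊤ ≡ G ⊤ → InBase K F w → InBase K G w
  InBase-mono F≤G F⊤≡G⊤ (w≤F , w⊤≡F⊤) = (λ A → ≤-trans (w≤F A) (F≤G A)) , trans w⊤≡F⊤ F⊤≡G⊤

  InBase-*ˡ : ∀ {n} {G : Subset n → Carrier} {w : Fin n → Carrier} {c} → 0# ≤ c →
              InBase K G w → InBase K (λ A → c * G A) (λ i → c * w i)
  InBase-*ˡ {G = G} {w} {c} 0≤c (w≤G , w⊤≡G⊤) =
    (λ A → subst (_≤ c * G A) (sym (setSum-*ˡ c A w)) (*-monoʳ-≤-nonneg 0≤c (w≤G A))) ,
    trans (setSum-*ˡ c ⊤ w) (cong (c *_) w⊤≡G⊤)

lemma6 : (K : OrderedField) → let open OrderedField K in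
    (n : ℕ) (F G : Subset n → Carrier) →
    Submodular K F → Submodular K G →
    F ⊥ ≡ 0# → G ⊥ ≡ 0# → F ⊤ ≡ 0# → G ⊤ ≡ 0# →
    (α : Carrier) → 1# ≤ α →
    (∀ A → (α ⁻¹) * G A ≤ F A) → (∀ A → F A ≤ G A) →
    ((w : Fin n → Carrier) → InBase K G w → InBase K F (λ i → (α ⁻¹) * w i))
    × ((w : Fin n → Carrier) → InBase K F w → InBase K G w)
lemma6 K n F G _ _ _ _ F⊤≡0 G⊤≡0 α 1≤α α⁻¹G≤F F≤G =
  (λ _ → InBase-mono α⁻¹G≤F α⁻¹G⊤≡F⊤ ∘ InBase-*ˡ (1≤x⇒0≤x⁻¹ 1≤α)) ,
  (λ _ → InBase-mono F≤G (trans F⊤≡0 (sym G⊤≡0)))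
  where
  open OrderedField K
  open OrderedFieldProperties K
  open BasePolytope K
  open ≡-Reasoning
  α⁻¹G⊤≡F⊤ : α ⁻¹ * G ⊤ ≡ F ⊤
  α⁻¹G⊤≡F⊤ = begin
    α ⁻¹ * G ⊤ ≡⟨ cong (α ⁻¹ *_) G⊤≡0 ⟩
    α ⁻¹ * 0#  ≡⟨ zeroʳ (α ⁻¹) ⟩
    0#         ≡⟨ sym F⊤≡0 ⟩
    F ⊤        ∎
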